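{- Let $U$ be an ultrafilter on $\omega$ and $h\in\omega^\omega$ a finite-to-one function. If $U$ is Hausdorff, then $h(U)$ is also Hausdorff.
   Context: For $f\in\omega^\omega$ and an ultrafilter $U$ on $\omega$, $f(U)=\{X\subseteq\omega : f^{ -1}(X)\in U\}$. An ultrafilter $U$ on $\omega$ is Hausdorff if for any $f,g\in\omega^\omega$ with $f(U)=g(U)$ there exists $X\in U$ such that $f\restriction X=g\restriction X$. -}

module Defs where

open import Level using (0ℓ)
open import Data.Nat using (ℕ; _<_)
open import Data.Product using (Σ; ∃; _×_)
open import Data.Sum using (_⊎_)
open import Data.Empty using (⊥)
open import Relation.Nullary using (¬_)
open import Relation.Binary.PropositionalEquality using (_≡_)
open import Relation.Unary using (Pred; _⊆_; _∩_; ∁; U; ∅)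

Subset : Set₁
Subset = Pred ℕ 0ℓ

Family : Set₂
Family = Subset → Set₁

record IsUltrafilter (𝒰 : Family) : Set₁ where
  field
    univ    : 𝒰 U
    proper  : ¬ 𝒰 ∅
    upward  : ∀ {X Y : Subset} → X ⊆ Y → 𝒰 X → 𝒰 Y
    inter   : ∀ {X Y : Subset} → 𝒰 X → 𝒰 Y → 𝒰 (X ∩ Y)
    ultra   : ∀ (X : Subset) → 𝒰 X ⊎ 𝒰 (∁ X)

image : (ℕ → ℕ) → Family → Family
image f 𝒰 X = 𝒰 (λ n → X (f n))

SameFamily : Family → Family → Set₁
SameFamily 𝒰 𝒱 = ∀ (X : Subset) → (𝒰 X → 𝒱 X) × (𝒱 X → 𝒰 X)

IsHausdorff : Family → Set₁
IsHausdorff 𝒰 = ∀ (f g : ℕ → ℕ) → SameFamily (image f 𝒰) (image g 𝒰) →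
  Σ Subset (λ X → 𝒰 X × (∀ n → X n → f n ≡ g n))

FiniteToOne : (ℕ → ℕ) → Set
FiniteToOne h = ∀ m → ∃ λ N → ∀ n → h n ≡ m → n < N

-- Since f(h(U)) = (f ∘ h)(U), an agreement f(h(U)) = g(h(U)) is an agreement
-- (f ∘ h)(U) = (g ∘ h)(U); Hausdorffness of U makes f ∘ h and g ∘ h agree on
-- some X ∈ U, and then the preimage under h of the equaliser of f and g
-- contains X, so that equaliser lies in h(U).
module Submission where

open import Defs
open import Data.Nat using (ℕ)
open import Data.Product using (_,_)
open import Function using (_∘_)
open import Relation.Binary.PropositionalEquality using (_≡_)
open import Relation.Unary using (_⊆_)

UpwardClosed : Family → Set₁
UpwardClosed 𝒰 = ∀ {X Y : Subset} → X ⊆ Y → 𝒰 X → 𝒰 Y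

Equaliser : (ℕ → ℕ) → (ℕ → ℕ) → Subset
Equaliser f g n = f n ≡ g n

equaliser-∈-image : (𝒰 : Family) → UpwardClosed 𝒰 → (h f g : ℕ → ℕ) (X : Subset) →
                    𝒰 X → X ⊆ Equaliser (f ∘ h) (g ∘ h) →
                    image h 𝒰 (Equaliser f g)
equaliser-∈-image 𝒰 upward h f g X X∈𝒰 X⊆eq = upward X⊆eq X∈𝒰

image-preserves-Hausdorff : (𝒰 : Family) → UpwardClosed 𝒰 → (h : ℕ → ℕ) →
                            IsHausdorff 𝒰 → IsHausdorff (image h 𝒰)
image-preserves-Hausdorff 𝒰 upward h haus f g same
  with haus (f ∘ h) (g ∘ h) same
... | X , X∈𝒰 , agree =
  Equaliser f g , equaliser-∈-image 𝒰 upward h f g X X∈𝒰 (agree _) , λ _ eq → eq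

lemma2p6 : (𝒰 : Family) → IsUltrafilter 𝒰 → (h : ℕ → ℕ) → FiniteToOne h →
    IsHausdorff 𝒰 → IsHausdorff (image h 𝒰)
lemma2p6 𝒰 uf h _ = image-preserves-Hausdorff 𝒰 (IsUltrafilter.upward uf) h
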